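{- For every positive integer $k$ and every nonnegative integer $n$, $$\det\left(\frac{2i+k+1}{i+j+k}\binom{i+j+k}{i-j+1}\right)_{i,j=0}^{n-1}=\binom{2n+k-1}{n}\quad\text{and}\quad\det\left(\frac{i+k+1}{j+k}\binom{j+k}{i-j+1}\right)_{i,j=0}^{n-1}=\binom{2n+k-1}{n}.$$
   Context: Binomial coefficients $\binom{a}{b}$ with $a\ge0$ vanish if $b<0$ or $b>a$. Determinants of $0\times0$ matrices equal $1$. -}

module Defs where

open import Data.Nat using (ℕ; zero; suc; _+_; _*_; _∸_; _≤ᵇ_)
open import Data.Nat.Combinatorics using (_C_)
open import Data.Bool using (if_then_else_)
open import Data.Fin using (Fin; toℕ; punchIn) renaming (zero to fz; suc to fs)
open import Data.Integer using (+_)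
open import Data.Rational using (ℚ; _/_; -_) renaming (_+_ to _+q_; _*_ to _*q_)
import Data.Rational as Q

-- Binomial coefficient binom a (b₁ - b₂) with a ≥ 0 and integer lower index b₁ - b₂:
-- vanishes when b₁ - b₂ < 0 (and when it exceeds a, by the library's _C_).
binomDiff : ℕ → ℕ → ℕ → ℕ
binomDiff a b₁ b₂ = if b₂ ≤ᵇ b₁ then a C (b₁ ∸ b₂) else 0

-- The rational number a / b (only ever used with b ≥ 1; returns 0 if b = 0).
frac : ℕ → ℕ → ℚ
frac a zero    = Q.0ℚ
frac a (suc b) = (+ a) / suc b

fromℕ : ℕ → ℚ
fromℕ a = (+ a) / 1

sumFin : ∀ n → (Fin n → ℚ) → ℚ
sumFin zero    f = Q.0ℚ
sumFin (suc n) f = f fz +q sumFin n (λ i → f (fs i))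

sign : ℕ → ℚ
sign zero    = Q.1ℚ
sign (suc m) = - sign m

det : ∀ n → (Fin n → Fin n → ℚ) → ℚ
det zero    M = Q.1ℚ
det (suc n) M = sumFin (suc n) λ j →
  sign (toℕ j) *q (M fz j *q det n (λ r c → M (fs r) (punchIn j c)))

matA : ℕ → ∀ n → Fin n → Fin n → ℚ
matA k n i' j' = let i = toℕ i' ; j = toℕ j' in
  frac (2 * i + k + 1) (i + j + k) *q fromℕ (binomDiff (i + j + k) (i + 1) j)

matB : ℕ → ∀ n → Fin n → Fin n → ℚ
matB k n i' j' = let i = toℕ i' ; j = toℕ j' in
  frac (i + k + 1) (j + k) *q fromℕ (binomDiff (j + k) (i + 1) j)

-- Both matrices are lower Hessenberg with ones on the superdiagonal, so their leading
-- principal minors satisfy D (n + 1) = (-1)^n Σ_{j ≤ n} (-1)^j g(n, j) D j.  With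
-- D j = C(2j+k-1, j) each term factors as g(n, j) D j = F n · C(n+1, j) · P n j, where P n
-- is a polynomial of degree n in j: C(j+n+k-1, n) for the first matrix, C(2j+k-1, n) for the
-- second.  The full alternating sum Σ_{j ≤ n+1} (-1)^j C(n+1, j) P n j is an (n+1)-st finite
-- difference of P n, hence zero, so the recurrence collapses to its missing top term
-- F n · P n (n + 1), which an absorption identity turns into C(2n+k+1, n+1).

module Submission where

open import Defs
open import Data.Nat using (ℕ; zero; suc; _+_; _*_; _∸_; _!; _≤_; _<_; _≥_; _≤ᵇ_; s≤s; z≤n; NonZero)
open import Data.Nat.Properties
open import Data.Nat.Combinatorics
  using (_C_; nCk≡n!/k![n-k]!; k![n∸k]!∣n!; k>n⇒nCk≡0; nCk≡nC[n∸k]; nCn≡1; nCk+nC[k+1]≡[n+1]C[k+1])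
open import Data.Nat.DivMod using (_/_; m/n*n≡m)
open import Data.Nat.Induction using (<-rec)
open import Data.Nat.Tactic.RingSolver using (solve-∀)
open import Data.Bool using (true; false)
open import Data.Unit using (tt)
open import Data.Fin using (Fin; toℕ; punchIn) renaming (zero to fz; suc to fs)
open import Data.Product using (Σ; _×_; _,_)
open import Data.Integer as ℤ using (+_)
import Data.Integer.Properties as ℤ
open import Data.Rational using (ℚ; 0ℚ; 1ℚ; toℚᵘ)
  renaming (_+_ to _+ℚ_; _*_ to _*ℚ_; -_ to -ℚ_; _-_ to _-ℚ_)
import Data.Rational.Properties as ℚ
open import Data.Rational.Unnormalised using (mkℚᵘ; *≡*; _≃_)
import Data.Rational.Unnormalised.Properties as ℚᵘ
open import Data.Rational.Solver using (module +-*-Solver)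
open +-*-Solver using (solve; _:=_; _:+_; _:*_; :-_; _:-_; con)
open import Relation.Nullary using (yes; no; contradiction)
open import Relation.Binary.PropositionalEquality
open ≡-Reasoning

[m+n]Cm*m!*n!≡[m+n]! : ∀ m n → ((m + n) C m) * (m ! * n !) ≡ (m + n) !
[m+n]Cm*m!*n!≡[m+n]! m n = begin
  ((m + n) C m) * (m ! * n !)
    ≡⟨ cong (λ r → ((m + n) C m) * (m ! * r !)) (m+n∸m≡n m n) ⟨
  ((m + n) C m) * (m ! * (m + n ∸ m) !)
    ≡⟨ cong (_* (m ! * (m + n ∸ m) !)) (nCk≡n!/k![n-k]! (m≤m+n m n)) ⟩
  ((m + n) ! / (m ! * (m + n ∸ m) !)) * (m ! * (m + n ∸ m) !)
    ≡⟨ m/n*n≡m (k![n∸k]!∣n! (m≤m+n m n)) ⟩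
  (m + n) ! ∎
  where instance _ = m !* (m + n ∸ m) !≢0

[m+n]Cm≡[m+n]Cn : ∀ m n → (m + n) C m ≡ (m + n) C n
[m+n]Cm≡[m+n]Cn m n = trans (nCk≡nC[n∸k] (m≤m+n m n)) (cong ((m + n) C_) (m+n∸m≡n m n))

[1+k]*[1+n]C[1+k]≡[1+n]*nCk : ∀ n k → suc k * (suc n C suc k) ≡ suc n * (n C k)
[1+k]*[1+n]C[1+k]≡[1+n]*nCk n k with k ≤? n
... | no k≰n = begin
  suc k * (suc n C suc k) ≡⟨ cong (suc k *_) (k>n⇒nCk≡0 (s≤s (≰⇒> k≰n))) ⟩
  suc k * 0               ≡⟨ *-zeroʳ (suc k) ⟩
  0                       ≡⟨ *-zeroʳ (suc n) ⟨
  suc n * 0               ≡⟨ cong (suc n *_) (k>n⇒nCk≡0 (≰⇒> k≰n)) ⟨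
  suc n * (n C k)         ∎
... | yes k≤n with m≤n⇒∃[o]m+o≡n k≤n
...   | r , refl = *-cancelʳ-≡ _ _ (k ! * r !) {{k !* r !≢0}} (begin
  suc k * ((suc k + r) C suc k) * (k ! * r !)   ≡⟨ s*c*[x*y]≡c*[s*x*y] (suc k) ((suc k + r) C suc k) (k !) (r !) ⟩
  ((suc k + r) C suc k) * (suc k ! * r !)      ≡⟨ [m+n]Cm*m!*n!≡[m+n]! (suc k) r ⟩
  suc (k + r) * (k + r) !                      ≡⟨ cong (suc (k + r) *_) ([m+n]Cm*m!*n!≡[m+n]! k r) ⟨
  suc (k + r) * (((k + r) C k) * (k ! * r !))  ≡⟨ *-assoc (suc (k + r)) ((k + r) C k) (k ! * r !) ⟨
  suc (k + r) * ((k + r) C k) * (k ! * r !)    ∎)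
  where
  s*c*[x*y]≡c*[s*x*y] : ∀ s c x y → s * c * (x * y) ≡ c * ((s * x) * y)
  s*c*[x*y]≡c*[s*x*y] = solve-∀

[1+k]*[k+1+r]C[1+k]≡[1+r]*[k+1+r]Ck : ∀ k r → suc k * ((k + suc r) C suc k) ≡ suc r * ((k + suc r) C k)
[1+k]*[k+1+r]C[1+k]≡[1+r]*[k+1+r]Ck k r = begin
  suc k * ((k + suc r) C suc k)   ≡⟨ cong (λ n → suc k * (n C suc k)) (+-suc k r) ⟩
  suc k * (suc (k + r) C suc k)   ≡⟨ [1+k]*[1+n]C[1+k]≡[1+n]*nCk (k + r) k ⟩
  suc (k + r) * ((k + r) C k)     ≡⟨ cong (suc (k + r) *_) ([m+n]Cm≡[m+n]Cn k r) ⟩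
  suc (k + r) * ((k + r) C r)     ≡⟨ [1+k]*[1+n]C[1+k]≡[1+n]*nCk (k + r) r ⟨
  suc r * (suc (k + r) C suc r)   ≡⟨ cong (λ n → suc r * (n C suc r)) (+-suc k r) ⟨
  suc r * ((k + suc r) C suc r)   ≡⟨ cong (suc r *_) ([m+n]Cm≡[m+n]Cn k (suc r)) ⟨
  suc r * ((k + suc r) C k)       ∎

[m+n]Cm*nCk≡[m+n]C[m+k]*[m+k]Cm : ∀ m n k →
  ((m + n) C m) * (n C k) ≡ ((m + n) C (m + k)) * ((m + k) C m)
[m+n]Cm*nCk≡[m+n]C[m+k]*[m+k]Cm m n k with k ≤? n
... | no k≰n = begin
  ((m + n) C m) * (n C k)  ≡⟨ cong (((m + n) C m) *_) (k>n⇒nCk≡0 (≰⇒> k≰n)) ⟩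
  ((m + n) C m) * 0        ≡⟨ *-zeroʳ ((m + n) C m) ⟩
  0                        ≡⟨ cong (_* ((m + k) C m)) (k>n⇒nCk≡0 (+-monoʳ-< m (≰⇒> k≰n))) ⟨
  ((m + n) C (m + k)) * ((m + k) C m) ∎
... | yes k≤n with m≤n⇒∃[o]m+o≡n k≤n
...   | e , refl = *-cancelʳ-≡ _ _ K {{K≢0}} (begin
  (A * B) * K                                    ≡⟨ regroupˡ A B (m !) (k !) (e !) ((m + k) !) ((k + e) !) ⟩
  (A * (m ! * (k + e) !)) * (B * (k ! * e !)) * (m + k) !
    ≡⟨ cong₂ (λ x y → x * y * (m + k) !) ([m+n]Cm*m!*n!≡[m+n]! m (k + e)) ([m+n]Cm*m!*n!≡[m+n]! k e) ⟩
  (m + (k + e)) ! * (k + e) ! * (m + k) !        ≡⟨ cong (λ x → x ! * (k + e) ! * (m + k) !) (+-assoc m k e) ⟨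
  (m + k + e) ! * (k + e) ! * (m + k) !
    ≡⟨ cong₂ (λ x y → x * (k + e) ! * y) ([m+n]Cm*m!*n!≡[m+n]! (m + k) e) ([m+n]Cm*m!*n!≡[m+n]! m k) ⟨
  (A′ * ((m + k) ! * e !)) * (k + e) ! * (B′ * (m ! * k !))
    ≡⟨ regroupʳ A′ B′ (m !) (k !) (e !) ((m + k) !) ((k + e) !) ⟩
  (A′ * B′) * K                                  ≡⟨ cong (λ x → (x C (m + k)) * B′ * K) (+-assoc m k e) ⟩
  (((m + (k + e)) C (m + k)) * B′) * K           ∎)
  where
  A = (m + (k + e)) C m
  B = (k + e) C k
  A′ = (m + k + e) C (m + k)
  B′ = (m + k) C m
  K = m ! * k ! * e ! * (m + k) ! * (k + e) !
  K≢0 : NonZero K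
  K≢0 = m*n≢0 _ _ {{m*n≢0 _ _ {{m*n≢0 _ _ {{m !* k !≢0}} {{e !≢0}}}} {{(m + k) !≢0}}}} {{(k + e) !≢0}}
  regroupˡ : ∀ a b x y z u v → (a * b) * (x * y * z * u * v) ≡ (a * (x * v)) * (b * (y * z)) * u
  regroupˡ = solve-∀
  regroupʳ : ∀ a b x y z u v → (a * (u * z)) * v * (b * (x * y)) ≡ (a * b) * (x * y * z * u * v)
  regroupʳ = solve-∀

toℚᵘ-fromℕ : ∀ a → toℚᵘ (fromℕ a) ≃ mkℚᵘ (+ a) 0
toℚᵘ-fromℕ a = ℚ.toℚᵘ-fromℚᵘ (mkℚᵘ (+ a) 0)

fromℕ-+ : ∀ a b → fromℕ (a + b) ≡ fromℕ a +ℚ fromℕ b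
fromℕ-+ a b = ℚ.toℚᵘ-injective (ℚᵘ.≃-trans (toℚᵘ-fromℕ (a + b)) (ℚᵘ.≃-sym (ℚᵘ.≃-trans
  (ℚ.toℚᵘ-homo-+ (fromℕ a) (fromℕ b))
  (ℚᵘ.≃-trans (ℚᵘ.+-cong (toℚᵘ-fromℕ a) (toℚᵘ-fromℕ b)) 
  (*≡* (cong (ℤ._* + 1) (cong₂ ℤ._+_ (ℤ.*-identityʳ (+ a)) (ℤ.*-identityʳ (+ b)))))))))

fromℕ-* : ∀ a b → fromℕ (a * b) ≡ fromℕ a *ℚ fromℕ b
fromℕ-* a b = ℚ.toℚᵘ-injective (ℚᵘ.≃-trans (toℚᵘ-fromℕ (a * b)) (ℚᵘ.≃-sym (ℚᵘ.≃-trans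
  (ℚ.toℚᵘ-homo-* (fromℕ a) (fromℕ b))
  (ℚᵘ.≃-trans (ℚᵘ.*-cong (toℚᵘ-fromℕ a) (toℚᵘ-fromℕ b)) (*≡* (cong (ℤ._* + 1) (sym (ℤ.pos-* a b))))))))

frac*denominator : ∀ a b → frac a (suc b) *ℚ fromℕ (suc b) ≡ fromℕ a
frac*denominator a b = ℚ.toℚᵘ-injective (ℚᵘ.≃-trans (ℚ.toℚᵘ-homo-* (frac a (suc b)) (fromℕ (suc b)))
  (ℚᵘ.≃-trans (ℚᵘ.*-cong (ℚ.toℚᵘ-fromℚᵘ (mkℚᵘ (+ a) b)) (toℚᵘ-fromℕ (suc b)))
  (ℚᵘ.≃-trans (*≡* (ℤ.*-assoc (+ a) (+ suc b) (+ 1))) (ℚᵘ.≃-sym (toℚᵘ-fromℕ a)))))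

*-cancelʳ-fromℕ-suc : ∀ b {x y} → x *ℚ fromℕ (suc b) ≡ y *ℚ fromℕ (suc b) → x ≡ y
*-cancelʳ-fromℕ-suc b {x} {y} eq = begin
  x                                             ≡⟨ ℚ.*-identityʳ x ⟨
  x *ℚ 1ℚ                                       ≡⟨ cong (x *ℚ_) (frac*denominator 1 b) ⟨
  x *ℚ (frac 1 (suc b) *ℚ fromℕ (suc b))        ≡⟨ move x ⟩
  (x *ℚ fromℕ (suc b)) *ℚ frac 1 (suc b)        ≡⟨ cong (_*ℚ frac 1 (suc b)) eq ⟩
  (y *ℚ fromℕ (suc b)) *ℚ frac 1 (suc b)        ≡⟨ move y ⟨
  y *ℚ (frac 1 (suc b) *ℚ fromℕ (suc b))        ≡⟨ cong (y *ℚ_) (frac*denominator 1 b) ⟩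
  y *ℚ 1ℚ                                       ≡⟨ ℚ.*-identityʳ y ⟩
  y                                             ∎
  where
  move : ∀ z → z *ℚ (frac 1 (suc b) *ℚ fromℕ (suc b)) ≡ (z *ℚ fromℕ (suc b)) *ℚ frac 1 (suc b)
  move z = solve 3 (λ z u v → z :* (u :* v) := (z :* v) :* u) refl z (frac 1 (suc b)) (fromℕ (suc b))

frac*fromℕ : ∀ c e y z → c * y ≡ suc e * z → frac c (suc e) *ℚ fromℕ y ≡ fromℕ z
frac*fromℕ c e y z cy≡ez = *-cancelʳ-fromℕ-suc e (begin
  frac c (suc e) *ℚ fromℕ y *ℚ fromℕ (suc e)
    ≡⟨ solve 3 (λ f y d → f :* y :* d := (f :* d) :* y) refl (frac c (suc e)) (fromℕ y) (fromℕ (suc e)) ⟩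
  (frac c (suc e) *ℚ fromℕ (suc e)) *ℚ fromℕ y ≡⟨ cong (_*ℚ fromℕ y) (frac*denominator c e) ⟩
  fromℕ c *ℚ fromℕ y                           ≡⟨ fromℕ-* c y ⟨
  fromℕ (c * y)                                ≡⟨ cong fromℕ cy≡ez ⟩
  fromℕ (suc e * z)                            ≡⟨ fromℕ-* (suc e) z ⟩
  fromℕ (suc e) *ℚ fromℕ z                     ≡⟨ ℚ.*-comm (fromℕ (suc e)) (fromℕ z) ⟩
  fromℕ z *ℚ fromℕ (suc e)                     ∎)

frac-rescale : ∀ c d e x y → x * suc e ≡ suc d * y → frac c (suc d) *ℚ fromℕ x ≡ frac c (suc e) *ℚ fromℕ y
frac-rescale c d e x y xe≡dy = *-cancelʳ-fromℕ-suc e (*-cancelʳ-fromℕ-suc d (begin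
  frac c (suc d) *ℚ fromℕ x *ℚ fromℕ (suc e) *ℚ fromℕ (suc d)
    ≡⟨ solve 4 (λ f x e d → f :* x :* e :* d := (f :* d) :* (x :* e))
         refl (frac c (suc d)) (fromℕ x) (fromℕ (suc e)) (fromℕ (suc d)) ⟩
  (frac c (suc d) *ℚ fromℕ (suc d)) *ℚ (fromℕ x *ℚ fromℕ (suc e))
    ≡⟨ cong₂ _*ℚ_ (frac*denominator c d) (sym (fromℕ-* x (suc e))) ⟩
  fromℕ c *ℚ fromℕ (x * suc e)
    ≡⟨ cong (λ t → fromℕ c *ℚ fromℕ t) xe≡dy ⟩
  fromℕ c *ℚ fromℕ (suc d * y)
    ≡⟨ cong₂ _*ℚ_ (sym (frac*denominator c e)) (fromℕ-* (suc d) y) ⟩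
  (frac c (suc e) *ℚ fromℕ (suc e)) *ℚ (fromℕ (suc d) *ℚ fromℕ y)
    ≡⟨ solve 4 (λ f y e d → (f :* e) :* (d :* y) := f :* y :* e :* d)
         refl (frac c (suc e)) (fromℕ y) (fromℕ (suc e)) (fromℕ (suc d)) ⟩
  frac c (suc e) *ℚ fromℕ y *ℚ fromℕ (suc e) *ℚ fromℕ (suc d) ∎))

sumℕ : ℕ → (ℕ → ℚ) → ℚ
sumℕ zero    f = 0ℚ
sumℕ (suc n) f = f 0 +ℚ sumℕ n (λ j → f (suc j))

sumℕ-cong : ∀ n {f h} → (∀ j → j < n → f j ≡ h j) → sumℕ n f ≡ sumℕ n h
sumℕ-cong zero    f≡h = refl
sumℕ-cong (suc n) f≡h = cong₂ _+ℚ_ (f≡h 0 (s≤s z≤n)) (sumℕ-cong n (λ j j<n → f≡h (suc j) (s≤s j<n)))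

sumℕ-zero : ∀ n {f} → (∀ j → f j ≡ 0ℚ) → sumℕ n f ≡ 0ℚ
sumℕ-zero zero    f≡0 = refl
sumℕ-zero (suc n) f≡0 = cong₂ _+ℚ_ (f≡0 0) (sumℕ-zero n (λ j → f≡0 (suc j)))

sumℕ-+ : ∀ n f h → sumℕ n (λ j → f j +ℚ h j) ≡ sumℕ n f +ℚ sumℕ n h
sumℕ-+ zero    f h = refl
sumℕ-+ (suc n) f h = trans (cong (f 0 +ℚ h 0 +ℚ_) (sumℕ-+ n _ _))
  (solve 4 (λ a b c d → (a :+ b) :+ (c :+ d) := (a :+ c) :+ (b :+ d)) refl
    (f 0) (h 0) (sumℕ n (λ j → f (suc j))) (sumℕ n (λ j → h (suc j))))

sumℕ-*ˡ : ∀ n x f → sumℕ n (λ j → x *ℚ f j) ≡ x *ℚ sumℕ n f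
sumℕ-*ˡ zero    x f = sym (ℚ.*-zeroʳ x)
sumℕ-*ˡ (suc n) x f = trans (cong (x *ℚ f 0 +ℚ_) (sumℕ-*ˡ n x _))
  (sym (ℚ.*-distribˡ-+ x (f 0) (sumℕ n (λ j → f (suc j)))))

sumℕ-init-last : ∀ n f → sumℕ (suc n) f ≡ sumℕ n f +ℚ f n
sumℕ-init-last zero    f = ℚ.+-comm (f 0) 0ℚ
sumℕ-init-last (suc n) f = trans (cong (f 0 +ℚ_) (sumℕ-init-last n (λ j → f (suc j))))
  (sym (ℚ.+-assoc (f 0) (sumℕ n (λ j → f (suc j))) (f (suc n))))

punchInℕ : ℕ → ℕ → ℕ
punchInℕ zero    c       = suc c
punchInℕ (suc j) zero    = zero
punchInℕ (suc j) (suc c) = suc (punchInℕ j c)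

toℕ-punchIn : ∀ {n} (j : Fin (suc n)) (c : Fin n) → toℕ (punchIn j c) ≡ punchInℕ (toℕ j) (toℕ c)
toℕ-punchIn fz     c      = refl
toℕ-punchIn (fs j) fz     = refl
toℕ-punchIn (fs j) (fs c) = cong suc (toℕ-punchIn j c)

minor : ℕ → (ℕ → ℕ → ℚ) → ℕ → ℕ → ℚ
minor j g r c = g (suc r) (punchInℕ j c)

detℕ : ℕ → (ℕ → ℕ → ℚ) → ℚ
detℕ zero    g = 1ℚ
detℕ (suc n) g = sumℕ (suc n) (λ j → sign j *ℚ (g 0 j *ℚ detℕ n (minor j g)))

sumFin≡sumℕ : ∀ n {f h} → (∀ i → f i ≡ h (toℕ i)) → sumFin n f ≡ sumℕ n h
sumFin≡sumℕ zero    f≡h = refl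
sumFin≡sumℕ (suc n) f≡h = cong₂ _+ℚ_ (f≡h fz) (sumFin≡sumℕ n (λ i → f≡h (fs i)))

det≡detℕ : ∀ n {M g} → (∀ i j → M i j ≡ g (toℕ i) (toℕ j)) → det n M ≡ detℕ n g
det≡detℕ zero    M≡g = refl
det≡detℕ (suc n) {g = g} M≡g =
  sumFin≡sumℕ (suc n) {h = λ j → sign j *ℚ (g 0 j *ℚ detℕ n (minor j g))} λ j →
  cong (sign (toℕ j) *ℚ_) (cong₂ _*ℚ_ (M≡g fz j) (det≡detℕ n λ r c →
    trans (M≡g (fs r) (punchIn j c)) (cong (g (suc (toℕ r))) (toℕ-punchIn j c))))

record UnitHessenberg (g : ℕ → ℕ → ℚ) : Set where
  field
    zero-above-superdiagonal : ∀ i j → g i (suc (suc (i + j))) ≡ 0ℚ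
    one-on-superdiagonal     : ∀ i → g i (suc i) ≡ 1ℚ

minor-unitHessenberg : ∀ {g j} → j ≤ 1 → UnitHessenberg g → UnitHessenberg (minor j g)
minor-unitHessenberg z≤n       H = record
  { zero-above-superdiagonal = λ i → zero-above-superdiagonal (suc i)
  ; one-on-superdiagonal     = λ i → one-on-superdiagonal (suc i) }
  where open UnitHessenberg H
minor-unitHessenberg (s≤s z≤n) H = record
  { zero-above-superdiagonal = λ i → zero-above-superdiagonal (suc i)
  ; one-on-superdiagonal     = λ i → one-on-superdiagonal (suc i) }
  where open UnitHessenberg H

detℕ-unitHessenberg-firstRow : ∀ {g} → UnitHessenberg g → ∀ m →
  detℕ (suc (suc m)) g ≡ g 0 0 *ℚ detℕ (suc m) (minor 0 g) -ℚ detℕ (suc m) (minor 1 g)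
detℕ-unitHessenberg-firstRow {g} H m = begin
  1ℚ *ℚ (g 0 0 *ℚ dN) +ℚ ((-ℚ 1ℚ) *ℚ (g 0 1 *ℚ dM) +ℚ sumℕ m rest)
    ≡⟨ cong₂ (λ u v → 1ℚ *ℚ (g 0 0 *ℚ dN) +ℚ ((-ℚ 1ℚ) *ℚ (u *ℚ dM) +ℚ v))
         (one-on-superdiagonal 0) (sumℕ-zero m rest≡0) ⟩
  1ℚ *ℚ (g 0 0 *ℚ dN) +ℚ ((-ℚ 1ℚ) *ℚ (1ℚ *ℚ dM) +ℚ 0ℚ)
    ≡⟨ solve 3 (λ x a b → con 1ℚ :* (x :* a) :+ ((:- con 1ℚ) :* (con 1ℚ :* b) :+ con 0ℚ) := x :* a :- b)
         refl (g 0 0) dN dM ⟩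
  g 0 0 *ℚ dN -ℚ dM ∎
  where
  open UnitHessenberg H
  dN = detℕ (suc m) (minor 0 g)
  dM = detℕ (suc m) (minor 1 g)
  rest : ℕ → ℚ
  rest j = sign (suc (suc j)) *ℚ (g 0 (suc (suc j)) *ℚ detℕ (suc m) (minor (suc (suc j)) g))
  rest≡0 : ∀ j → rest j ≡ 0ℚ
  rest≡0 j = trans (cong (λ u → sign (suc (suc j)) *ℚ (u *ℚ d)) (zero-above-superdiagonal 0 j))
    (solve 2 (λ s d → s :* (con 0ℚ :* d) := con 0ℚ) refl (sign (suc (suc j))) d)
    where d = detℕ (suc m) (minor (suc (suc j)) g)

lastRowExpansion : (ℕ → ℕ → ℚ) → ℕ → ℚ
lastRowExpansion g n = sign n *ℚ sumℕ (suc n) (λ j → sign j *ℚ (g n j *ℚ detℕ j g))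

detℕ-unitHessenberg-lastRow : ∀ n {g} → UnitHessenberg g → detℕ (suc n) g ≡ lastRowExpansion g n
detℕ-unitHessenberg-lastRow zero    {g} H =
  solve 1 (λ x → con 1ℚ :* (x :* con 1ℚ) :+ con 0ℚ := con 1ℚ :* (con 1ℚ :* (x :* con 1ℚ) :+ con 0ℚ)) refl (g 0 0)
-- The minors N and M have the same last row except in column 0, so after expanding them by
-- the inductive hypothesis the two sums recombine into the last-row expansion of g.
detℕ-unitHessenberg-lastRow (suc m) {g} H = begin
  detℕ (suc (suc m)) g
    ≡⟨ detℕ-unitHessenberg-firstRow H m ⟩
  x *ℚ detℕ (suc m) N -ℚ detℕ (suc m) M
    ≡⟨ cong₂ (λ u v → x *ℚ u -ℚ v) (detℕ-unitHessenberg-lastRow m (minor-unitHessenberg z≤n H))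
                                  (detℕ-unitHessenberg-lastRow m (minor-unitHessenberg (s≤s z≤n) H)) ⟩
  x *ℚ (s *ℚ (1ℚ *ℚ (G₁ *ℚ 1ℚ) +ℚ tail N)) -ℚ s *ℚ (1ℚ *ℚ (G₀ *ℚ 1ℚ) +ℚ tail M)
    ≡⟨ solve 6 (λ x s G₀ G₁ tN tM →
         x :* (s :* (con 1ℚ :* (G₁ :* con 1ℚ) :+ tN)) :- s :* (con 1ℚ :* (G₀ :* con 1ℚ) :+ tM)
         := (:- s) :* (con 1ℚ :* (G₀ :* con 1ℚ)
                      :+ ((:- con 1ℚ) :* (G₁ :* (con 1ℚ :* (x :* con 1ℚ) :+ con 0ℚ)) :+ ((:- x) :* tN :+ tM))))
         refl x s G₀ G₁ (tail N) (tail M) ⟩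
  (-ℚ s) *ℚ (1ℚ *ℚ (G₀ *ℚ 1ℚ) +ℚ ((-ℚ 1ℚ) *ℚ (G₁ *ℚ detℕ 1 g) +ℚ ((-ℚ x) *ℚ tail N +ℚ tail M)))
    ≡⟨ cong (λ t → (-ℚ s) *ℚ (1ℚ *ℚ (G₀ *ℚ 1ℚ) +ℚ ((-ℚ 1ℚ) *ℚ (G₁ *ℚ detℕ 1 g) +ℚ t)))
            (sym tail-expansion) ⟩
  lastRowExpansion g (suc m) ∎
  where
  x = g 0 0
  s = sign m
  N = minor 0 g
  M = minor 1 g
  G₀ = g (suc m) 0
  G₁ = g (suc m) 1
  tail : (ℕ → ℕ → ℚ) → ℚ
  tail h = sumℕ m (λ i → sign (suc i) *ℚ (g (suc m) (suc (suc i)) *ℚ detℕ (suc i) h))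
  tail-expansion : sumℕ m (λ i → sign (suc (suc i)) *ℚ (g (suc m) (suc (suc i)) *ℚ detℕ (suc (suc i)) g))
                 ≡ (-ℚ x) *ℚ tail N +ℚ tail M
  tail-expansion = begin
    sumℕ m (λ i → sign (suc (suc i)) *ℚ (g (suc m) (suc (suc i)) *ℚ detℕ (suc (suc i)) g))
      ≡⟨ sumℕ-cong m (λ i _ → trans (cong (λ d → sign (suc (suc i)) *ℚ (g (suc m) (suc (suc i)) *ℚ d))
                                          (detℕ-unitHessenberg-firstRow H i))
           (solve 5 (λ x σ G a b → (:- σ) :* (G :* (x :* a :- b)) := (:- x) :* (σ :* (G :* a)) :+ σ :* (G :* b))
              refl x (sign (suc i)) (g (suc m) (suc (suc i))) (detℕ (suc i) N) (detℕ (suc i) M))) ⟩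
    sumℕ m (λ i → (-ℚ x) *ℚ (sign (suc i) *ℚ (g (suc m) (suc (suc i)) *ℚ detℕ (suc i) N))
                  +ℚ sign (suc i) *ℚ (g (suc m) (suc (suc i)) *ℚ detℕ (suc i) M))
      ≡⟨ sumℕ-+ m _ _ ⟩
    sumℕ m (λ i → (-ℚ x) *ℚ (sign (suc i) *ℚ (g (suc m) (suc (suc i)) *ℚ detℕ (suc i) N))) +ℚ tail M
      ≡⟨ cong (_+ℚ tail M) (sumℕ-*ˡ m (-ℚ x) _) ⟩
    (-ℚ x) *ℚ tail N +ℚ tail M ∎

alternatingBinomialSum : ℕ → (ℕ → ℚ) → ℚ
alternatingBinomialSum m f = sumℕ (suc m) (λ j → sign j *ℚ (fromℕ (m C j) *ℚ f j))

alternatingBinomialSum-cong : ∀ m {f h} → (∀ j → f j ≡ h j) →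
  alternatingBinomialSum m f ≡ alternatingBinomialSum m h
alternatingBinomialSum-cong m f≡h =
  sumℕ-cong (suc m) (λ j _ → cong (λ y → sign j *ℚ (fromℕ (m C j) *ℚ y)) (f≡h j))

alternatingBinomialSum-+ : ∀ m f h →
  alternatingBinomialSum m (λ j → f j +ℚ h j) ≡ alternatingBinomialSum m f +ℚ alternatingBinomialSum m h
alternatingBinomialSum-+ m f h = trans
  (sumℕ-cong (suc m) {h = λ j → term f j +ℚ term h j} (λ j _ →
    solve 4 (λ s b x y → s :* (b :* (x :+ y)) := s :* (b :* x) :+ s :* (b :* y))
      refl (sign j) (fromℕ (m C j)) (f j) (h j)))
  (sumℕ-+ (suc m) (term f) (term h))
  where
  term : (ℕ → ℚ) → ℕ → ℚ
  term f j = sign j *ℚ (fromℕ (m C j) *ℚ f j)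

alternatingBinomialSum-suc : ∀ m f →
  alternatingBinomialSum (suc m) f ≡ alternatingBinomialSum m f -ℚ alternatingBinomialSum m (λ j → f (suc j))
alternatingBinomialSum-suc m f = begin
  h 0 +ℚ sumℕ (suc m) (λ j → sign (suc j) *ℚ (fromℕ (suc m C suc j) *ℚ f (suc j)))
    ≡⟨ cong (h 0 +ℚ_) (sumℕ-cong (suc m) (λ j _ → pascal j)) ⟩
  h 0 +ℚ sumℕ (suc m) (λ j → -ℚ 1ℚ *ℚ h′ j +ℚ h (suc j))
    ≡⟨ cong (h 0 +ℚ_) (sumℕ-+ (suc m) (λ j → -ℚ 1ℚ *ℚ h′ j) (λ j → h (suc j))) ⟩
  h 0 +ℚ (sumℕ (suc m) (λ j → -ℚ 1ℚ *ℚ h′ j) +ℚ T)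
    ≡⟨ cong (λ t → h 0 +ℚ (t +ℚ T)) (sumℕ-*ˡ (suc m) (-ℚ 1ℚ) h′) ⟩
  h 0 +ℚ (-ℚ 1ℚ *ℚ S′ +ℚ T)
    ≡⟨ solve 3 (λ a u t → a :+ ((:- con 1ℚ) :* u :+ t) := (a :+ t) :- u) refl (h 0) S′ T ⟩
  sumℕ (suc (suc m)) h -ℚ S′
    ≡⟨ cong (_-ℚ S′) (sumℕ-init-last (suc m) h) ⟩
  sumℕ (suc m) h +ℚ h (suc m) -ℚ S′
    ≡⟨ cong (λ t → sumℕ (suc m) h +ℚ t -ℚ S′) h[m+1]≡0 ⟩
  sumℕ (suc m) h +ℚ 0ℚ -ℚ S′
    ≡⟨ cong (_-ℚ S′) (ℚ.+-identityʳ (sumℕ (suc m) h)) ⟩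
  alternatingBinomialSum m f -ℚ S′ ∎
  where
  h : ℕ → ℚ
  h j = sign j *ℚ (fromℕ (m C j) *ℚ f j)
  h′ : ℕ → ℚ
  h′ j = sign j *ℚ (fromℕ (m C j) *ℚ f (suc j))
  S′ = alternatingBinomialSum m (λ j → f (suc j))
  T = sumℕ (suc m) (λ j → h (suc j))
  pascal : ∀ j → sign (suc j) *ℚ (fromℕ (suc m C suc j) *ℚ f (suc j)) ≡ -ℚ 1ℚ *ℚ h′ j +ℚ h (suc j)
  pascal j = begin
    sign (suc j) *ℚ (fromℕ (suc m C suc j) *ℚ f (suc j))
      ≡⟨ cong (λ b → sign (suc j) *ℚ (b *ℚ f (suc j))) (cong fromℕ (sym (nCk+nC[k+1]≡[n+1]C[k+1] m j))) ⟩
    sign (suc j) *ℚ (fromℕ (m C j + m C suc j) *ℚ f (suc j))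
      ≡⟨ cong (λ b → sign (suc j) *ℚ (b *ℚ f (suc j))) (fromℕ-+ (m C j) (m C suc j)) ⟩
    sign (suc j) *ℚ ((fromℕ (m C j) +ℚ fromℕ (m C suc j)) *ℚ f (suc j))
      ≡⟨ solve 4 (λ s b c y → (:- s) :* ((b :+ c) :* y) := (:- con 1ℚ) :* (s :* (b :* y)) :+ (:- s) :* (c :* y))
           refl (sign j) (fromℕ (m C j)) (fromℕ (m C suc j)) (f (suc j)) ⟩
    -ℚ 1ℚ *ℚ h′ j +ℚ h (suc j) ∎
  h[m+1]≡0 : h (suc m) ≡ 0ℚ
  h[m+1]≡0 = trans (cong (λ b → sign (suc m) *ℚ (fromℕ b *ℚ f (suc m))) (k>n⇒nCk≡0 (n<1+n m)))
    (solve 2 (λ s y → s :* (con 0ℚ :* y) := con 0ℚ) refl (sign (suc m)) (f (suc m)))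

DegreeAtMost : ℕ → (ℕ → ℚ) → Set
DegreeAtMost zero    f = ∀ j → f (suc j) ≡ f j
DegreeAtMost (suc d) f = Σ (ℕ → ℚ) λ Δf → DegreeAtMost d Δf × (∀ j → f (suc j) ≡ f j +ℚ Δf j)

DegreeAtMost-+ : ∀ d {f h} → DegreeAtMost d f → DegreeAtMost d h → DegreeAtMost d (λ j → f j +ℚ h j)
DegreeAtMost-+ zero    f-const h-const = λ j → cong₂ _+ℚ_ (f-const j) (h-const j)
DegreeAtMost-+ (suc d) {f} {h} (Δf , Δf-deg , f-step) (Δh , Δh-deg , h-step) =
  (λ j → Δf j +ℚ Δh j) , DegreeAtMost-+ d Δf-deg Δh-deg , λ j →
    trans (cong₂ _+ℚ_ (f-step j) (h-step j))
      (solve 4 (λ a b c d → (a :+ b) :+ (c :+ d) := (a :+ c) :+ (b :+ d)) refl (f j) (Δf j) (h j) (Δh j))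

alternatingBinomialSum-degree : ∀ d {f} → DegreeAtMost d f → alternatingBinomialSum (suc d) f ≡ 0ℚ
alternatingBinomialSum-degree zero {f} f-const = begin
  alternatingBinomialSum 1 f                                  ≡⟨ alternatingBinomialSum-suc 0 f ⟩
  alternatingBinomialSum 0 f -ℚ alternatingBinomialSum 0 (λ j → f (suc j))
    ≡⟨ cong (λ t → alternatingBinomialSum 0 f -ℚ t) (alternatingBinomialSum-cong 0 f-const) ⟩
  alternatingBinomialSum 0 f -ℚ alternatingBinomialSum 0 f   ≡⟨ ℚ.+-inverseʳ (alternatingBinomialSum 0 f) ⟩
  0ℚ                                                          ∎
alternatingBinomialSum-degree (suc d) {f} (Δf , Δf-deg , f-step) = begin
  alternatingBinomialSum (suc (suc d)) f                      ≡⟨ alternatingBinomialSum-suc (suc d) f ⟩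
  S -ℚ alternatingBinomialSum (suc d) (λ j → f (suc j))
    ≡⟨ cong (λ t → S -ℚ t) (alternatingBinomialSum-cong (suc d) f-step) ⟩
  S -ℚ alternatingBinomialSum (suc d) (λ j → f j +ℚ Δf j)
    ≡⟨ cong (λ t → S -ℚ t) (alternatingBinomialSum-+ (suc d) f Δf) ⟩
  S -ℚ (S +ℚ alternatingBinomialSum (suc d) Δf)
    ≡⟨ cong (λ t → S -ℚ (S +ℚ t)) (alternatingBinomialSum-degree d Δf-deg) ⟩
  S -ℚ (S +ℚ 0ℚ)
    ≡⟨ solve 1 (λ s → s :- (s :+ con 0ℚ) := con 0ℚ) refl S ⟩
  0ℚ ∎
  where S = alternatingBinomialSum (suc d) f

C[j+c]-degree : ∀ n c → DegreeAtMost n (λ j → fromℕ ((j + c) C n))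
C[j+c]-degree zero    c = λ j → refl
C[j+c]-degree (suc n) c = (λ j → fromℕ ((j + c) C n)) , C[j+c]-degree n c , λ j → begin
  fromℕ (suc (j + c) C suc n)                      ≡⟨ cong fromℕ (nCk+nC[k+1]≡[n+1]C[k+1] (j + c) n) ⟨
  fromℕ ((j + c) C n + (j + c) C suc n)            ≡⟨ fromℕ-+ ((j + c) C n) ((j + c) C suc n) ⟩
  fromℕ ((j + c) C n) +ℚ fromℕ ((j + c) C suc n)   ≡⟨ ℚ.+-comm _ (fromℕ ((j + c) C suc n)) ⟩
  fromℕ ((j + c) C suc n) +ℚ fromℕ ((j + c) C n)   ∎

C[2j+c]-degree : ∀ n c → DegreeAtMost n (λ j → fromℕ ((j + j + c) C n))
C[2j+c]-degree zero    c = λ j → refl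
C[2j+c]-degree (suc n) c =
  (λ j → fromℕ ((j + j + c) C n) +ℚ fromℕ ((j + j + suc c) C n)) ,
  DegreeAtMost-+ n (C[2j+c]-degree n c) (C[2j+c]-degree n (suc c)) , λ j → let x = j + j + c in begin
    fromℕ ((suc j + suc j + c) C suc n)
      ≡⟨ cong (λ m → fromℕ (m C suc n)) (cong suc (cong (_+ c) (+-suc j j))) ⟩
    fromℕ (suc (suc x) C suc n)
      ≡⟨ cong fromℕ (nCk+nC[k+1]≡[n+1]C[k+1] (suc x) n) ⟨
    fromℕ (suc x C n + suc x C suc n)
      ≡⟨ cong (λ m → fromℕ (suc x C n + m)) (nCk+nC[k+1]≡[n+1]C[k+1] x n) ⟨
    fromℕ (suc x C n + (x C n + x C suc n))
      ≡⟨ cong fromℕ (rotate (suc x C n) (x C n) (x C suc n)) ⟩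
    fromℕ (x C suc n + (x C n + suc x C n))
      ≡⟨ trans (fromℕ-+ (x C suc n) _) (cong (fromℕ (x C suc n) +ℚ_) (fromℕ-+ (x C n) (suc x C n))) ⟩
    fromℕ (x C suc n) +ℚ (fromℕ (x C n) +ℚ fromℕ (suc x C n))
      ≡⟨ cong (λ m → fromℕ (x C suc n) +ℚ (fromℕ (x C n) +ℚ fromℕ (m C n))) (+-suc (j + j) c) ⟨
    fromℕ (x C suc n) +ℚ (fromℕ (x C n) +ℚ fromℕ ((j + j + suc c) C n)) ∎
  where
  rotate : ∀ u v w → u + (v + w) ≡ w + (v + u)
  rotate = solve-∀

sign*sign≡1 : ∀ n → sign n *ℚ sign n ≡ 1ℚ
sign*sign≡1 zero    = refl
sign*sign≡1 (suc n) = trans (solve 1 (λ s → (:- s) :* (:- s) := s :* s) refl (sign n)) (sign*sign≡1 n)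

alternatingBinomialSum-init : ∀ n {f} → DegreeAtMost n f →
  sumℕ (suc n) (λ j → sign j *ℚ (fromℕ (suc n C j) *ℚ f j)) ≡ sign n *ℚ f (suc n)
alternatingBinomialSum-init n {f} f-deg = begin
  sumℕ (suc n) h                           ≡⟨ solve 2 (λ t y → t := (t :+ (:- y)) :+ y) refl (sumℕ (suc n) h) y ⟩
  (sumℕ (suc n) h -ℚ y) +ℚ y               ≡⟨ cong (λ t → (sumℕ (suc n) h +ℚ t) +ℚ y) -y≡last ⟩
  (sumℕ (suc n) h +ℚ h (suc n)) +ℚ y       ≡⟨ cong (_+ℚ y) (sumℕ-init-last (suc n) h) ⟨
  alternatingBinomialSum (suc n) f +ℚ y   ≡⟨ cong (_+ℚ y) (alternatingBinomialSum-degree n f-deg) ⟩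
  0ℚ +ℚ y                                 ≡⟨ ℚ.+-identityˡ y ⟩
  y                                       ∎
  where
  h : ℕ → ℚ
  h j = sign j *ℚ (fromℕ (suc n C j) *ℚ f j)
  y = sign n *ℚ f (suc n)
  -y≡last : -ℚ y ≡ h (suc n)
  -y≡last = trans (solve 2 (λ s p → :- (s :* p) := (:- s) :* (con 1ℚ :* p)) refl (sign n) (f (suc n)))
                  (cong (λ c → sign (suc n) *ℚ (fromℕ c *ℚ f (suc n))) (sym (nCn≡1 (suc n))))

record BinomialFactorisation (g : ℕ → ℕ → ℚ) (D : ℕ → ℚ) : Set where
  field
    scale       : ℕ → ℚ
    poly        : ℕ → ℕ → ℚ
    poly-degree : ∀ n → DegreeAtMost n (poly n)
    factorise   : ∀ p j → let n = p + j in g n j *ℚ D j ≡ scale n *ℚ (fromℕ (suc n C j) *ℚ poly n j)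
    top         : ∀ n → scale n *ℚ poly n (suc n) ≡ D (suc n)

detℕ-unitHessenberg-factorised : ∀ {g D} → UnitHessenberg g → BinomialFactorisation g D → D 0 ≡ 1ℚ →
  ∀ n → detℕ n g ≡ D n
detℕ-unitHessenberg-factorised {g} {D} H F D0≡1 = <-rec (λ n → detℕ n g ≡ D n) step
  where
  open BinomialFactorisation F
  factorise≤ : ∀ n j → j ≤ n → g n j *ℚ D j ≡ scale n *ℚ (fromℕ (suc n C j) *ℚ poly n j)
  factorise≤ n j j≤n with n ∸ j | m∸n+n≡m j≤n
  ... | p | refl = factorise p j
  step : ∀ n → (∀ {j} → j < n → detℕ j g ≡ D j) → detℕ n g ≡ D n
  step zero    _   = sym D0≡1
  step (suc n) ind = begin
    detℕ (suc n) g                                          ≡⟨ detℕ-unitHessenberg-lastRow n H ⟩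
    s *ℚ sumℕ (suc n) (λ j → sign j *ℚ (g n j *ℚ detℕ j g))  ≡⟨ cong (s *ℚ_) (sumℕ-cong (suc n) term≡) ⟩
    s *ℚ sumℕ (suc n) (λ j → scale n *ℚ h j)                ≡⟨ cong (s *ℚ_) (sumℕ-*ˡ (suc n) (scale n) h) ⟩
    s *ℚ (scale n *ℚ sumℕ (suc n) h)
      ≡⟨ cong (λ t → s *ℚ (scale n *ℚ t)) (alternatingBinomialSum-init n (poly-degree n)) ⟩
    s *ℚ (scale n *ℚ (s *ℚ poly n (suc n)))
      ≡⟨ solve 3 (λ s c p → s :* (c :* (s :* p)) := (s :* s) :* (c :* p)) refl s (scale n) (poly n (suc n)) ⟩
    (s *ℚ s) *ℚ (scale n *ℚ poly n (suc n))                 ≡⟨ cong₂ _*ℚ_ (sign*sign≡1 n) (top n) ⟩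
    1ℚ *ℚ D (suc n)                                         ≡⟨ ℚ.*-identityˡ (D (suc n)) ⟩
    D (suc n)                                               ∎
    where
    s = sign n
    h : ℕ → ℚ
    h j = sign j *ℚ (fromℕ (suc n C j) *ℚ poly n j)
    term≡ : ∀ j → j < suc n → sign j *ℚ (g n j *ℚ detℕ j g) ≡ scale n *ℚ h j
    term≡ j j≤n = begin
      sign j *ℚ (g n j *ℚ detℕ j g)  ≡⟨ cong (λ d → sign j *ℚ (g n j *ℚ d)) (ind j≤n) ⟩
      sign j *ℚ (g n j *ℚ D j)       ≡⟨ cong (sign j *ℚ_) (factorise≤ n j (≤-pred j≤n)) ⟩
      sign j *ℚ (scale n *ℚ (fromℕ (suc n C j) *ℚ poly n j))
        ≡⟨ solve 3 (λ σ c t → σ :* (c :* t) := c :* (σ :* t))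
             refl (sign j) (scale n) (fromℕ (suc n C j) *ℚ poly n j) ⟩
      scale n *ℚ h j                 ∎

binomDiff-≤ : ∀ a {b₁ b₂} → b₂ ≤ b₁ → binomDiff a b₁ b₂ ≡ a C (b₁ ∸ b₂)
binomDiff-≤ a {b₁} {b₂} b₂≤b₁ with b₂ ≤ᵇ b₁ | ≤⇒≤ᵇ b₂≤b₁
... | true | _ = refl

binomDiff-> : ∀ a {b₁ b₂} → b₁ < b₂ → binomDiff a b₁ b₂ ≡ 0
binomDiff-> a {b₁} {b₂} b₁<b₂ with b₂ ≤ᵇ b₁ | ≤ᵇ⇒≤ b₂ b₁
... | false | _     = refl
... | true  | b₂≤b₁ = contradiction (b₂≤b₁ tt) (<⇒≱ b₁<b₂)

matAℕ matBℕ : ℕ → ℕ → ℕ → ℚ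
matAℕ k i j = frac (2 * i + k + 1) (i + j + k) *ℚ fromℕ (binomDiff (i + j + k) (i + 1) j)
matBℕ k i j = frac (i + k + 1) (j + k) *ℚ fromℕ (binomDiff (j + k) (i + 1) j)

closedForm : ℕ → ℕ → ℚ
closedForm k n = fromℕ ((2 * n + k ∸ 1) C n)

entry-superdiagonal : ∀ {c d} e a i → c ≡ suc e → d ≡ suc e →
  frac c d *ℚ fromℕ (binomDiff a (i + 1) (suc i)) ≡ 1ℚ
entry-superdiagonal e a i refl refl = begin
  frac (suc e) (suc e) *ℚ fromℕ (binomDiff a (i + 1) (suc i))
    ≡⟨ cong (λ b → frac (suc e) (suc e) *ℚ fromℕ b) (binomDiff-≤ a (≤-reflexive (+-comm 1 i))) ⟩
  frac (suc e) (suc e) *ℚ fromℕ (a C (i + 1 ∸ suc i))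
    ≡⟨ cong (λ b → frac (suc e) (suc e) *ℚ fromℕ (a C b))
            (trans (cong (_∸ suc i) (+-comm i 1)) (n∸n≡0 (suc i))) ⟩
  frac (suc e) (suc e) *ℚ fromℕ 1
    ≡⟨ frac*fromℕ (suc e) e 1 1 refl ⟩
  1ℚ ∎

entry-above-superdiagonal : ∀ c d a i j → frac c d *ℚ fromℕ (binomDiff a (i + 1) (suc (suc (i + j)))) ≡ 0ℚ
entry-above-superdiagonal c d a i j =
  trans (cong (λ b → frac c d *ℚ fromℕ b)
               (binomDiff-> a (s≤s (≤-trans (≤-reflexive (+-comm i 1)) (s≤s (m≤m+n i j))))))
        (ℚ.*-zeroʳ (frac c d))

matA-unitHessenberg : ∀ k → UnitHessenberg (matAℕ k)
matA-unitHessenberg k = record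
  { zero-above-superdiagonal = λ i j → let j′ = suc (suc (i + j)) in
      entry-above-superdiagonal (2 * i + k + 1) (i + j′ + k) (i + j′ + k) i j
  ; one-on-superdiagonal     = λ i → entry-superdiagonal (i + i + k) _ i (numerator i k) (denominator i k) }
  where
  numerator : ∀ i k → 2 * i + k + 1 ≡ suc (i + i + k)
  numerator = solve-∀
  denominator : ∀ i k → i + suc i + k ≡ suc (i + i + k)
  denominator = solve-∀

matB-unitHessenberg : ∀ k → UnitHessenberg (matBℕ k)
matB-unitHessenberg k = record
  { zero-above-superdiagonal = λ i j → let j′ = suc (suc (i + j)) in
      entry-above-superdiagonal (i + k + 1) (j′ + k) (j′ + k) i j
  ; one-on-superdiagonal     = λ i → entry-superdiagonal (i + k) _ i (+-comm (i + k) 1) refl }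

matA-binomialIdentity : ∀ p j a → let n = p + j in
  ((n + j + suc a) C suc p) * ((j + (j + a)) C j) * suc n
    ≡ suc (n + j + a) * ((suc n C j) * ((j + (n + a)) C n))
matA-binomialIdentity p j a = begin
  ((p + j + j + suc a) C suc p) * ((j + q) C j) * suc (p + j)
    ≡⟨ cong (λ x → (x C suc p) * ((j + q) C j) * suc (p + j)) (p+j+j+[1+a]≡[1+p]+[j+[j+a]] p j a) ⟩
  ((suc p + (j + q)) C suc p) * ((j + q) C j) * suc (p + j)
    ≡⟨ cong (_* suc (p + j)) ([m+n]Cm*nCk≡[m+n]C[m+k]*[m+k]Cm (suc p) (j + q) j) ⟩
  ((suc p + (j + q)) C suc (p + j)) * ((suc p + j) C suc p) * suc (p + j)
    ≡⟨ cong₂ (λ x y → (x C suc (p + j)) * y * suc (p + j))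
             (cong suc (sym (+-assoc p j q))) ([m+n]Cm≡[m+n]Cn (suc p) j) ⟩
  (suc N C suc (p + j)) * (suc (p + j) C j) * suc (p + j)
    ≡⟨ x*y*s≡s*x*y (suc N C suc (p + j)) (suc (p + j) C j) (suc (p + j)) ⟩
  suc (p + j) * (suc N C suc (p + j)) * (suc (p + j) C j)
    ≡⟨ cong (_* (suc (p + j) C j)) ([1+k]*[1+n]C[1+k]≡[1+n]*nCk N (p + j)) ⟩
  suc N * (N C (p + j)) * (suc (p + j) C j)
    ≡⟨ cong₂ (λ x y → suc x * (y C (p + j)) * (suc (p + j) C j))
             (sym (+-assoc (p + j) j a)) (p+j+[j+a]≡j+[p+j+a] p j a) ⟩
  suc (p + j + j + a) * ((j + (p + j + a)) C (p + j)) * (suc (p + j) C j)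
    ≡⟨ s*x*y≡s*[y*x] (suc (p + j + j + a)) ((j + (p + j + a)) C (p + j)) (suc (p + j) C j) ⟩
  suc (p + j + j + a) * ((suc (p + j) C j) * ((j + (p + j + a)) C (p + j))) ∎
  where
  q = j + a
  N = p + j + q
  p+j+j+[1+a]≡[1+p]+[j+[j+a]] : ∀ p j a → p + j + j + suc a ≡ suc p + (j + (j + a))
  p+j+j+[1+a]≡[1+p]+[j+[j+a]] = solve-∀
  p+j+[j+a]≡j+[p+j+a] : ∀ p j a → p + j + (j + a) ≡ j + (p + j + a)
  p+j+[j+a]≡j+[p+j+a] = solve-∀
  x*y*s≡s*x*y : ∀ x y s → x * y * s ≡ s * x * y
  x*y*s≡s*x*y = solve-∀
  s*x*y≡s*[y*x] : ∀ s x y → s * x * y ≡ s * (y * x)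
  s*x*y≡s*[y*x] = solve-∀

matB-binomialIdentity : ∀ p j a → let n = p + j in
  ((j + suc a) C suc p) * ((j + (j + a)) C j) * suc n
    ≡ suc (j + a) * ((suc n C j) * ((j + j + a) C n))
matB-binomialIdentity p j a = *-cancelˡ-≡ _ _ (suc p) (trans scaledLhs (sym scaledRhs))
  where
  m = j + a
  s*[x*y*z]≡s*x*y*z : ∀ s x y z → s * (x * y * z) ≡ s * x * y * z
  s*[x*y*z]≡s*x*y*z = solve-∀
  s*x*y*z≡s*z*[y*x] : ∀ s x y z → s * x * y * z ≡ s * z * (y * x)
  s*x*y*z≡s*z*[y*x] = solve-∀
  s*[t*[x*y]]≡t*[s*x]*y : ∀ s t x y → s * (t * (x * y)) ≡ t * (s * x) * y
  s*[t*[x*y]]≡t*[s*x]*y = solve-∀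
  s*[t*x]*y≡s*t*[y*x] : ∀ s t x y → s * (t * x) * y ≡ s * t * (y * x)
  s*[t*x]*y≡s*t*[y*x] = solve-∀
  common = suc m * suc (p + j) * (((j + m) C (j + p)) * ((j + p) C j))
  scaledLhs : suc p * (((j + suc a) C suc p) * ((j + m) C j) * suc (p + j)) ≡ common
  scaledLhs = begin
    suc p * (((j + suc a) C suc p) * ((j + m) C j) * suc (p + j))
      ≡⟨ cong (λ x → suc p * ((x C suc p) * ((j + m) C j) * suc (p + j))) (+-suc j a) ⟩
    suc p * ((suc m C suc p) * ((j + m) C j) * suc (p + j))
      ≡⟨ s*[x*y*z]≡s*x*y*z (suc p) (suc m C suc p) ((j + m) C j) (suc (p + j)) ⟩
    suc p * (suc m C suc p) * ((j + m) C j) * suc (p + j)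
      ≡⟨ cong (λ x → x * ((j + m) C j) * suc (p + j)) ([1+k]*[1+n]C[1+k]≡[1+n]*nCk m p) ⟩
    suc m * (m C p) * ((j + m) C j) * suc (p + j)
      ≡⟨ s*x*y*z≡s*z*[y*x] (suc m) (m C p) ((j + m) C j) (suc (p + j)) ⟩
    suc m * suc (p + j) * (((j + m) C j) * (m C p))
      ≡⟨ cong (suc m * suc (p + j) *_) ([m+n]Cm*nCk≡[m+n]C[m+k]*[m+k]Cm j m p) ⟩
    common ∎
  scaledRhs : suc p * (suc m * ((suc (p + j) C j) * ((j + j + a) C (p + j)))) ≡ common
  scaledRhs = begin
    suc p * (suc m * ((suc (p + j) C j) * ((j + j + a) C (p + j))))
      ≡⟨ cong (λ x → suc p * (suc m * (x * ((j + j + a) C (p + j))))) ([m+n]Cm≡[m+n]Cn (suc p) j) ⟨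
    suc p * (suc m * ((suc (p + j) C suc p) * ((j + j + a) C (p + j))))
      ≡⟨ s*[t*[x*y]]≡t*[s*x]*y (suc p) (suc m) (suc (p + j) C suc p) ((j + j + a) C (p + j)) ⟩
    suc m * (suc p * (suc (p + j) C suc p)) * ((j + j + a) C (p + j))
      ≡⟨ cong (λ x → suc m * x * ((j + j + a) C (p + j))) ([1+k]*[1+n]C[1+k]≡[1+n]*nCk (p + j) p) ⟩
    suc m * (suc (p + j) * ((p + j) C p)) * ((j + j + a) C (p + j))
      ≡⟨ cong₂ (λ x y → suc m * (suc (p + j) * x) * y) [p+j]Cp≡[j+p]Cj [j+j+a]C[p+j]≡[j+m]C[j+p] ⟩
    suc m * (suc (p + j) * ((j + p) C j)) * ((j + m) C (j + p))
      ≡⟨ s*[t*x]*y≡s*t*[y*x] (suc m) (suc (p + j)) ((j + p) C j) ((j + m) C (j + p)) ⟩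
    common ∎
    where
    [p+j]Cp≡[j+p]Cj : (p + j) C p ≡ (j + p) C j
    [p+j]Cp≡[j+p]Cj = trans (cong (_C p) (+-comm p j)) (sym ([m+n]Cm≡[m+n]Cn j p))
    [j+j+a]C[p+j]≡[j+m]C[j+p] : (j + j + a) C (p + j) ≡ (j + m) C (j + p)
    [j+j+a]C[p+j]≡[j+m]C[j+p] = cong₂ _C_ (+-assoc j j a) (+-comm p j)

frac-rescale-product : ∀ c d e x₁ x₂ y₁ y₂ → x₁ * x₂ * suc e ≡ suc d * (y₁ * y₂) →
  frac c (suc d) *ℚ fromℕ x₁ *ℚ fromℕ x₂ ≡ frac c (suc e) *ℚ (fromℕ y₁ *ℚ fromℕ y₂)
frac-rescale-product c d e x₁ x₂ y₁ y₂ eq = begin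
  frac c (suc d) *ℚ fromℕ x₁ *ℚ fromℕ x₂     ≡⟨ ℚ.*-assoc (frac c (suc d)) (fromℕ x₁) (fromℕ x₂) ⟩
  frac c (suc d) *ℚ (fromℕ x₁ *ℚ fromℕ x₂)   ≡⟨ cong (frac c (suc d) *ℚ_) (fromℕ-* x₁ x₂) ⟨
  frac c (suc d) *ℚ fromℕ (x₁ * x₂)          ≡⟨ frac-rescale c d e (x₁ * x₂) (y₁ * y₂) eq ⟩
  frac c (suc e) *ℚ fromℕ (y₁ * y₂)          ≡⟨ cong (frac c (suc e) *ℚ_) (fromℕ-* y₁ y₂) ⟩
  frac c (suc e) *ℚ (fromℕ y₁ *ℚ fromℕ y₂)   ∎

p+j+1∸j≡1+p : ∀ p j → p + j + 1 ∸ j ≡ suc p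
p+j+1∸j≡1+p p j = trans (cong (_∸ j) (+-comm (p + j) 1)) (m+n∸n≡m (suc p) j)

2j+[1+a]∸1≡j+[j+a] : ∀ j a → 2 * j + suc a ∸ 1 ≡ j + (j + a)
2j+[1+a]∸1≡j+[j+a] j a = cong (_∸ 1) (2j+[1+a]≡1+j+[j+a] j a)
  where
  2j+[1+a]≡1+j+[j+a] : ∀ j a → 2 * j + suc a ≡ suc (j + (j + a))
  2j+[1+a]≡1+j+[j+a] = solve-∀

matA-factorise : ∀ a p j → let n = p + j in
  matAℕ (suc a) n j *ℚ closedForm (suc a) j
    ≡ frac (2 * n + suc a + 1) (suc n) *ℚ (fromℕ (suc n C j) *ℚ fromℕ ((j + (n + a)) C n))
matA-factorise a p j = begin
  frac c (p + j + j + suc a) *ℚ fromℕ (binomDiff (p + j + j + suc a) (p + j + 1) j) *ℚ fromℕ ((2 * j + suc a ∸ 1) C j)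
    ≡⟨ cong₂ (λ d x₁ → frac c d *ℚ fromℕ x₁ *ℚ fromℕ ((2 * j + suc a ∸ 1) C j)) (+-suc (p + j + j) a)
         (trans (binomDiff-≤ (p + j + j + suc a) (≤-trans (m≤n+m j p) (m≤m+n (p + j) 1)))
                (cong ((p + j + j + suc a) C_) (p+j+1∸j≡1+p p j))) ⟩
  frac c (suc (p + j + j + a)) *ℚ fromℕ ((p + j + j + suc a) C suc p) *ℚ fromℕ ((2 * j + suc a ∸ 1) C j)
    ≡⟨ cong (λ x₂ → frac c (suc (p + j + j + a)) *ℚ fromℕ ((p + j + j + suc a) C suc p) *ℚ fromℕ (x₂ C j))
         (2j+[1+a]∸1≡j+[j+a] j a) ⟩
  frac c (suc (p + j + j + a)) *ℚ fromℕ ((p + j + j + suc a) C suc p) *ℚ fromℕ ((j + (j + a)) C j)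
    ≡⟨ frac-rescale-product c (p + j + j + a) (p + j) ((p + j + j + suc a) C suc p) ((j + (j + a)) C j)
                 (suc (p + j) C j) ((j + (p + j + a)) C (p + j)) (matA-binomialIdentity p j a) ⟩
  frac c (suc (p + j)) *ℚ (fromℕ (suc (p + j) C j) *ℚ fromℕ ((j + (p + j + a)) C (p + j))) ∎
  where c = 2 * (p + j) + suc a + 1

matB-factorise : ∀ a p j → let n = p + j in
  matBℕ (suc a) n j *ℚ closedForm (suc a) j
    ≡ frac (n + suc a + 1) (suc n) *ℚ (fromℕ (suc n C j) *ℚ fromℕ ((j + j + a) C n))
matB-factorise a p j = begin
  frac c (j + suc a) *ℚ fromℕ (binomDiff (j + suc a) (p + j + 1) j) *ℚ fromℕ ((2 * j + suc a ∸ 1) C j)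
    ≡⟨ cong₂ (λ d x₁ → frac c d *ℚ fromℕ x₁ *ℚ fromℕ ((2 * j + suc a ∸ 1) C j)) (+-suc j a)
         (trans (binomDiff-≤ (j + suc a) (≤-trans (m≤n+m j p) (m≤m+n (p + j) 1)))
                (cong ((j + suc a) C_) (p+j+1∸j≡1+p p j))) ⟩
  frac c (suc (j + a)) *ℚ fromℕ ((j + suc a) C suc p) *ℚ fromℕ ((2 * j + suc a ∸ 1) C j)
    ≡⟨ cong (λ x₂ → frac c (suc (j + a)) *ℚ fromℕ ((j + suc a) C suc p) *ℚ fromℕ (x₂ C j))
         (2j+[1+a]∸1≡j+[j+a] j a) ⟩
  frac c (suc (j + a)) *ℚ fromℕ ((j + suc a) C suc p) *ℚ fromℕ ((j + (j + a)) C j)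
    ≡⟨ frac-rescale-product c (j + a) (p + j) ((j + suc a) C suc p) ((j + (j + a)) C j)
                 (suc (p + j) C j) ((j + j + a) C (p + j)) (matB-binomialIdentity p j a) ⟩
  frac c (suc (p + j)) *ℚ (fromℕ (suc (p + j) C j) *ℚ fromℕ ((j + j + a) C (p + j))) ∎
  where c = p + j + suc a + 1

matA-top : ∀ a n → frac (2 * n + suc a + 1) (suc n) *ℚ fromℕ ((suc n + (n + a)) C n) ≡ closedForm (suc a) (suc n)
matA-top a n = frac*fromℕ (2 * n + suc a + 1) n (N C n) ((2 * suc n + suc a ∸ 1) C suc n) (begin
  (2 * n + suc a + 1) * (N C n)     ≡⟨ cong (_* (N C n)) (numerator n a) ⟩
  suc N * (N C n)                   ≡⟨ [1+k]*[1+n]C[1+k]≡[1+n]*nCk N n ⟨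
  suc n * (suc N C suc n)           ≡⟨ cong (λ m → suc n * (m C suc n)) (cong (_∸ 1) (top-index n a)) ⟨
  suc n * ((2 * suc n + suc a ∸ 1) C suc n) ∎)
  where
  N = suc n + (n + a)
  numerator : ∀ n a → 2 * n + suc a + 1 ≡ suc (suc n + (n + a))
  numerator = solve-∀
  top-index : ∀ n a → 2 * suc n + suc a ≡ suc (suc (suc n + (n + a)))
  top-index = solve-∀

matB-top : ∀ a n → frac (n + suc a + 1) (suc n) *ℚ fromℕ ((suc n + suc n + a) C n) ≡ closedForm (suc a) (suc n)
matB-top a n = frac*fromℕ (n + suc a + 1) n ((suc n + suc n + a) C n) ((2 * suc n + suc a ∸ 1) C suc n) (begin
  (n + suc a + 1) * ((suc n + suc n + a) C n)   ≡⟨ cong₂ (λ c m → c * (m C n)) (+-comm (n + suc a) 1) (middle n a) ⟩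
  suc r * ((n + suc r) C n)                     ≡⟨ [1+k]*[k+1+r]C[1+k]≡[1+r]*[k+1+r]Ck n r ⟨
  suc n * ((n + suc r) C suc n)                 ≡⟨ cong (λ m → suc n * (m C suc n)) (cong (_∸ 1) (top-index n a)) ⟨
  suc n * ((2 * suc n + suc a ∸ 1) C suc n)     ∎)
  where
  r = n + suc a
  middle : ∀ n a → suc n + suc n + a ≡ n + suc (n + suc a)
  middle = solve-∀
  top-index : ∀ n a → 2 * suc n + suc a ≡ suc (n + suc (n + suc a))
  top-index = solve-∀

matA-factorisation : ∀ a → BinomialFactorisation (matAℕ (suc a)) (closedForm (suc a))
matA-factorisation a = record
  { scale       = λ n → frac (2 * n + suc a + 1) (suc n)
  ; poly        = λ n j → fromℕ ((j + (n + a)) C n)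
  ; poly-degree = λ n → C[j+c]-degree n (n + a)
  ; factorise   = matA-factorise a
  ; top         = matA-top a }

matB-factorisation : ∀ a → BinomialFactorisation (matBℕ (suc a)) (closedForm (suc a))
matB-factorisation a = record
  { scale       = λ n → frac (n + suc a + 1) (suc n)
  ; poly        = λ n j → fromℕ ((j + j + a) C n)
  ; poly-degree = λ n → C[2j+c]-degree n a
  ; factorise   = matB-factorise a
  ; top         = matB-top a }

mainTheorem13 : ∀ (k n : ℕ) → k ≥ 1 →
    (det n (matA k n) ≡ fromℕ ((2 * n + k ∸ 1) C n))
      × (det n (matB k n) ≡ fromℕ ((2 * n + k ∸ 1) C n))
mainTheorem13 (suc a) n _ =
    trans (det≡detℕ n {g = matAℕ (suc a)} (λ _ _ → refl))
          (detℕ-unitHessenberg-factorised (matA-unitHessenberg (suc a)) (matA-factorisation a) refl n)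
  , trans (det≡detℕ n {g = matBℕ (suc a)} (λ _ _ → refl))
          (detℕ-unitHessenberg-factorised (matB-unitHessenberg (suc a)) (matB-factorisation a) refl n)
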